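{- Let $B$ be an $m\times n$ matrix with integer entries. Then $D_k^*(B)$ divides $g_n(B^T)\,g_m(B)\,D_k(B)$ for all $k\in\{2,3,\dotsc,\min\{m,n\}\}$.
   Context: For an $m\times n$ integer matrix $B$ and $I\subseteq[m]$, $J\subseteq[n]$ with $|I|=|J|=k$, $B_{I,J}$ denotes the determinant of the submatrix of $B$ with rows in $I$ and columns in $J$. $D_k(B)$ is the greatest common divisor of all $k\times k$ minors $B_{I,J}$ of $B$, and $D_k^*(B)$ is the greatest common divisor of all $B_{I,J}$ with $|I|=|J|=k$, $m\in I$, $n\in J$ (minors including the last row and last column). For a matrix $C$ with rows indexed by $i$, $g_i(C)$ denotes the greatest common divisor of the entries of row $i$ of $C$; $B^T$ is the transpose of $B$ (so $g_n(B^T)$ is the gcd of the entries of the last column of $B$, and $g_m(B)$ the gcd of the entries of the last row of $B$). -}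

module Defs where

open import Data.Nat using (ℕ; zero; suc)
open import Data.Nat.GCD using (gcd)
open import Data.Bool using (Bool; true; false; _∨_)
open import Data.Fin using (Fin; zero; suc; fromℕ; toℕ; punchIn; _≟_)
open import Data.Integer using (ℤ; ∣_∣; -_; _+_; _*_; +_)
open import Data.Vec using (Vec; []; _∷_; lookup)
import Data.Product
import Data.Vec
import Data.List
open import Data.List using (List; []; _∷_; map; _++_; foldr; allFin; filterᵇ)
open import Relation.Nullary.Decidable using (⌊_⌋)

Matrix : ℕ → ℕ → Set
Matrix m n = Fin m → Fin n → ℤ

sgn : ℕ → ℤ
sgn zero = + 1
sgn (suc i) = - sgn i

sumFin : (n : ℕ) → (Fin n → ℤ) → ℤ
sumFin zero f = + 0
sumFin (suc n) f = f zero + sumFin n (λ i → f (suc i))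

det : (k : ℕ) → Matrix k k → ℤ
det zero A = + 1
det (suc k) A =
  sumFin (suc k) (λ j → sgn (toℕ j) * A zero j * det k (λ r c → A (suc r) (punchIn j c)))

-- all k-element subsets of Fin m, as strictly increasing vectors of indices
subsets : (k m : ℕ) → List (Vec (Fin m) k)
subsets zero m = [] ∷ []
subsets (suc k) zero = []
subsets (suc k) (suc m) =
  map (λ v → zero ∷ Data.Vec.map suc v) (subsets k m) ++ map (Data.Vec.map suc) (subsets (suc k) m)

sub : ∀ {m n k} → Matrix m n → Vec (Fin m) k → Vec (Fin n) k → Matrix k k
sub B I J r c = B (lookup I r) (lookup J c)

minor : ∀ {m n k} → Matrix m n → Vec (Fin m) k → Vec (Fin n) k → ℤ
minor {k = k} B I J = det k (sub B I J)

-- gcd of a list of integers (as a natural number; gcd of the empty list is 0)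
gcdList : List ℤ → ℕ
gcdList = foldr (λ x g → gcd ∣ x ∣ g) 0

memb : ∀ {m k} → Fin m → Vec (Fin m) k → Bool
memb i [] = false
memb i (x ∷ v) = ⌊ i ≟ x ⌋ ∨ memb i v

allPairs : ∀ {A C : Set} → List A → List C → List (Data.Product._×_ A C)
allPairs xs ys = Data.List.concatMap (λ x → map (λ y → x Data.Product., y) ys) xs

D : ∀ {m n} → (k : ℕ) → Matrix m n → ℕ
D {m} {n} k B =
  gcdList (map (λ p → minor B (Data.Product.proj₁ p) (Data.Product.proj₂ p))
               (allPairs (subsets k m) (subsets k n)))

-- D*_k(B) for an (suc m)×(suc n) matrix: gcd of k×k minors using the last row and last column
Dstar : ∀ {m n} → (k : ℕ) → Matrix (suc m) (suc n) → ℕ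
Dstar {m} {n} k B =
  gcdList (map (λ p → minor B (Data.Product.proj₁ p) (Data.Product.proj₂ p))
               (allPairs (filterᵇ (memb (fromℕ m)) (subsets k (suc m)))
                         (filterᵇ (memb (fromℕ n)) (subsets k (suc n)))))

g : ∀ {m n} → Fin m → Matrix m n → ℕ
g {n = n} i C = gcdList (map (C i) (allFin n))

_ᵀ : ∀ {m n} → Matrix m n → Matrix n m
(B ᵀ) i j = B j i

{-# OPTIONS --safe #-}
module Submission where

-- Let d = D*ₖ(B) and call a minor a corner minor when it uses the last row and the last column.
-- First, d divides every corner (k+1)-minor Δ. As k ≥ 2, Δ has two rows other than the last; expand
-- Δ along them. Every cofactor outside the last column is a corner k-minor, so modulo d only the
-- last-column terms e_{r'r} survive: Δ ≡ e₀₀ and −Δ ≡ e₁₁, while the alien expansions give d ∣ e₁₀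
-- and d ∣ e₀₁. Since e₀₀e₁₁ = e₁₀e₀₁, d² divides Δ(Δ − γ) for some γ ≡ 0 (mod d), forcing d ∣ Δ.
-- Next, bordering a k-minor M through the last row by row i and the last column, and expanding along
-- the new row, gives d ∣ B_{i,n}·M; bordering an arbitrary k-minor M by the last row and column j,
-- and expanding along the new column, then gives d ∣ B_{i,n}·B_{m,j}·M. Taking gcds over i, j and M
-- proves the claim.

open import Defs
open import Data.Nat using (ℕ; suc)

module FinSum where

  open import Data.Nat using (zero)
  open import Data.Fin using (Fin; zero; suc; punchIn)
  open import Data.Integer using (ℤ; +_; -_; _+_; _-_; _*_)
  open import Data.Integer.Properties using (*-zeroˡ; *-zeroʳ; *-distribˡ-+; +-identityˡ; neg-distrib-+)
  open import Data.Integer.Divisibility.Signed using (_∣_; divides; ∣m∣n⇒∣m+n; ∣m+n∣n⇒∣m; ∣n⇒∣m*n)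
  open import Data.Integer.Tactic.RingSolver using (solve-∀)
  open import Function using (_∘_)
  open import Relation.Binary.PropositionalEquality

  sumFin-cong : ∀ n {f h : Fin n → ℤ} → (∀ i → f i ≡ h i) → sumFin n f ≡ sumFin n h
  sumFin-cong zero    eq = refl
  sumFin-cong (suc n) eq = cong₂ _+_ (eq zero) (sumFin-cong n (eq ∘ suc))

  *-distribˡ-sumFin : ∀ n c (f : Fin n → ℤ) → c * sumFin n f ≡ sumFin n (λ i → c * f i)
  *-distribˡ-sumFin zero    c f = *-zeroʳ c
  *-distribˡ-sumFin (suc n) c f =
    trans (*-distribˡ-+ c (f zero) _) (cong (_+_ (c * f zero)) (*-distribˡ-sumFin n c (f ∘ suc)))

  sumFin-distrib-+ : ∀ n (f h : Fin n → ℤ) → sumFin n (λ i → f i + h i) ≡ sumFin n f + sumFin n h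
  sumFin-distrib-+ zero    f h = refl
  sumFin-distrib-+ (suc n) f h =
    trans (cong (_+_ (f zero + h zero)) (sumFin-distrib-+ n (f ∘ suc) (h ∘ suc))) (interchange (f zero) (h zero) _ _)
    where
    interchange : ∀ a b c e → a + b + (c + e) ≡ a + c + (b + e)
    interchange = solve-∀

  sumFin-zero : ∀ n → sumFin n (λ _ → + 0) ≡ + 0
  sumFin-zero zero    = refl
  sumFin-zero (suc n) = trans (+-identityˡ _) (sumFin-zero n)

  sumFin-comm : ∀ a b (f : Fin a → Fin b → ℤ) →
    sumFin a (λ i → sumFin b (f i)) ≡ sumFin b (λ j → sumFin a (λ i → f i j))
  sumFin-comm zero    b f = sym (sumFin-zero b)
  sumFin-comm (suc a) b f =
    trans (cong (_+_ (sumFin b (f zero))) (sumFin-comm a b (f ∘ suc)))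
          (sym (sumFin-distrib-+ b (f zero) (λ j → sumFin a (λ i → f (suc i) j))))

  sumFin-extract : ∀ n (p : Fin (suc n)) (f : Fin (suc n) → ℤ) →
    sumFin (suc n) f ≡ f p + sumFin n (f ∘ punchIn p)
  sumFin-extract n       zero    f = refl
  sumFin-extract (suc n) (suc p) f =
    trans (cong (_+_ (f zero)) (sumFin-extract n p (f ∘ suc))) (exchange (f zero) (f (suc p)) _)
    where
    exchange : ∀ a b c → a + (b + c) ≡ b + (a + c)
    exchange = solve-∀

  neg-distrib-sumFin : ∀ n (f : Fin n → ℤ) → sumFin n (λ i → - f i) ≡ - sumFin n f
  neg-distrib-sumFin zero    f = refl
  neg-distrib-sumFin (suc n) f =
    trans (cong (_+_ (- f zero)) (neg-distrib-sumFin n (f ∘ suc))) (sym (neg-distrib-+ (f zero) _))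

  _∣0 : ∀ d → d ∣ + 0
  d ∣0 = divides (+ 0) (sym (*-zeroˡ d))

  ∣-sumFin : ∀ {d} n (f : Fin n → ℤ) → (∀ i → d ∣ f i) → d ∣ sumFin n f
  ∣-sumFin {d} zero    f d∣f = d ∣0
  ∣-sumFin     (suc n) f d∣f = ∣m∣n⇒∣m+n (d∣f zero) (∣-sumFin n (f ∘ suc) (d∣f ∘ suc))

  ∣*-sumFin : ∀ {d} x n (a h : Fin n → ℤ) → (∀ i → d ∣ x * h i) → d ∣ x * sumFin n (λ i → a i * h i)
  ∣*-sumFin x n a h d∣xh = subst (_ ∣_) (sym (*-distribˡ-sumFin n x (λ i → a i * h i)))
    (∣-sumFin n _ λ i → subst (_ ∣_) (exchange (a i) x (h i)) (∣n⇒∣m*n (a i) (d∣xh i)))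
    where
    exchange : ∀ a x h → a * (x * h) ≡ x * (a * h)
    exchange = solve-∀

  ∣-pivot : ∀ {d x u v} → x ≡ u + v → d ∣ x → d ∣ v → d ∣ u
  ∣-pivot x≡u+v d∣x d∣v = ∣m+n∣n⇒∣m (subst (_ ∣_) x≡u+v d∣x) d∣v

  ∣-residue : ∀ {d x u v} → x ≡ u + v → d ∣ v → d ∣ x - u
  ∣-residue {u = u} {v} x≡u+v = subst (_ ∣_) (sym (trans (cong (_- u) x≡u+v) (cancel u v)))
    where
    cancel : ∀ u v → u + v - u ≡ v
    cancel = solve-∀

module Determinant where

  open FinSum
  open import Data.Nat using (zero)
  open import Data.Fin using (Fin; zero; suc; toℕ; punchIn; punchOut)
  open import Data.Fin.Properties using (punchInᵢ≢i; punchIn-punchOut)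
  open import Data.Integer using (ℤ; +_; -_; +[1+_]; -[1+_]; _+_; _*_)
  open import Data.Integer.Properties using (*-identityˡ; *-zeroʳ; neg-distribʳ-*; neg-distribˡ-*)
  open import Data.Integer.Divisibility.Signed using (_∣_; ∣n⇒∣m*n)
  open import Data.Integer.Tactic.RingSolver using (solve-∀)
  open import Data.Vec.Functional using (updateAt)
  open import Data.Vec.Functional.Properties using (updateAt-updates; updateAt-minimal)
  open import Data.Empty using (⊥-elim)
  open import Function using (_∘_)
  open import Relation.Binary.PropositionalEquality

  sign : ∀ {n} → Fin n → ℤ
  sign j = sgn (toℕ j)

  sgn-*-involutive : ∀ i x → sgn i * (sgn i * x) ≡ x
  sgn-*-involutive zero    x = trans (*-identityˡ _) (*-identityˡ x)
  sgn-*-involutive (suc i) x = trans (neg-neg (sgn i) x) (sgn-*-involutive i x)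
    where
    neg-neg : ∀ a x → (- a) * ((- a) * x) ≡ a * (a * x)
    neg-neg = solve-∀

  ∣sgn*⇒∣ : ∀ {d} i x → d ∣ sgn i * x → d ∣ x
  ∣sgn*⇒∣ i x d∣ = subst (_ ∣_) (sgn-*-involutive i x) (∣n⇒∣m*n (sgn i) d∣)

  sgn-*-≡0 : ∀ i x → sgn i * x ≡ + 0 → x ≡ + 0
  sgn-*-≡0 i x eq = trans (sym (sgn-*-involutive i x)) (trans (cong (sgn i *_) eq) (*-zeroʳ (sgn i)))

  x≡-x⇒x≡0 : ∀ x → x ≡ - x → x ≡ + 0
  x≡-x⇒x≡0 (+ 0)    _  = refl
  x≡-x⇒x≡0 +[1+ n ] ()
  x≡-x⇒x≡0 -[1+ n ] ()

  strike : ∀ {k} → Matrix (suc k) (suc k) → Fin (suc k) → Fin (suc k) → Matrix k k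
  strike A r c a b = A (punchIn r a) (punchIn c b)

  det-cong : ∀ k {A A' : Matrix k k} → (∀ r c → A r c ≡ A' r c) → det k A ≡ det k A'
  det-cong zero    eq = refl
  det-cong (suc k) eq = sumFin-cong (suc k) (λ j →
    cong₂ (λ x y → sign j * x * y) (eq zero j) (det-cong k (λ r c → eq (suc r) (punchIn j c))))

  det-expand-col₀ : ∀ k (A : Matrix (suc k) (suc k)) →
    det (suc k) A ≡ sumFin (suc k) (λ i → sign i * A i zero * det k (strike A i zero))
  det-expand-col₀ zero    A = refl
  det-expand-col₀ (suc k) A = cong (_+_ (sign {suc (suc k)} zero * A zero zero * det (suc k) (strike A zero zero))) (begin
      sumFin (suc k) (λ j → (- sign j) * A zero (suc j) * det (suc k) (strike A zero (suc j)))
    ≡⟨ sumFin-cong (suc k) (λ j → cong ((- sign j) * A zero (suc j) *_) (det-expand-col₀ k (strike A zero (suc j)))) ⟩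
      sumFin (suc k) (λ j → (- sign j) * A zero (suc j) * sumFin (suc k) (λ i → sign i * A (suc i) zero * C i j))
    ≡⟨ sumFin-cong (suc k) (λ j →
         *-distribˡ-sumFin (suc k) ((- sign j) * A zero (suc j)) (λ i → sign i * A (suc i) zero * C i j)) ⟩
      sumFin (suc k) (λ j → sumFin (suc k) (λ i → (- sign j) * A zero (suc j) * (sign i * A (suc i) zero * C i j)))
    ≡⟨ sumFin-comm (suc k) (suc k) (λ j i → (- sign j) * A zero (suc j) * (sign i * A (suc i) zero * C i j)) ⟩
      sumFin (suc k) (λ i → sumFin (suc k) (λ j → (- sign j) * A zero (suc j) * (sign i * A (suc i) zero * C i j)))
    ≡⟨ sumFin-cong (suc k) (λ i → sumFin-cong (suc k) (λ j →
         exchange (sign j) (A zero (suc j)) (sign i) (A (suc i) zero) (C i j))) ⟩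
      sumFin (suc k) (λ i → sumFin (suc k) (λ j → (- sign i) * A (suc i) zero * (sign j * A zero (suc j) * C i j)))
    ≡⟨ sumFin-cong (suc k) (λ i →
         sym (*-distribˡ-sumFin (suc k) ((- sign i) * A (suc i) zero) (λ j → sign j * A zero (suc j) * C i j))) ⟩
      sumFin (suc k) (λ i → (- sign i) * A (suc i) zero * det (suc k) (strike A (suc i) zero))
    ∎)
    where
    open ≡-Reasoning
    C : Fin (suc k) → Fin (suc k) → ℤ
    C i j = det k (λ r c → A (suc (punchIn i r)) (suc (punchIn j c)))
    exchange : ∀ x y z w u → (- x) * y * (z * w * u) ≡ (- z) * w * (x * y * u)
    exchange = solve-∀

  det-transpose : ∀ k (A : Matrix k k) → det k (A ᵀ) ≡ det k A
  det-transpose zero    A = refl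
  det-transpose (suc k) A = trans
    (sumFin-cong (suc k) (λ j → cong (sign j * A j zero *_) (det-transpose k (strike A j zero))))
    (sym (det-expand-col₀ k A))

  swap₀₁ : ∀ {k} → Fin (suc (suc k)) → Fin (suc (suc k))
  swap₀₁ zero          = suc zero
  swap₀₁ (suc zero)    = zero
  swap₀₁ (suc (suc c)) = suc (suc c)

  det-swap-cols₀₁ : ∀ k (A : Matrix (suc (suc k)) (suc (suc k))) →
    det (suc (suc k)) (λ r c → A r (swap₀₁ c)) ≡ - det (suc (suc k)) A

  det-strike-swap-cols₀₁ : ∀ k (A : Matrix (suc (suc k)) (suc (suc k))) (j : Fin k) →
    det (suc k) (strike (λ r c → A r (swap₀₁ c)) zero (suc (suc j))) ≡ - det (suc k) (strike A zero (suc (suc j)))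

  det-swap-cols₀₁ k A = begin
      det (suc (suc k)) A'
    ≡⟨ cong₂ _+_
         (cong (+ 1 * A zero (suc zero) *_)
           (det-cong (suc k) {strike A' zero zero} {strike A zero (suc zero)} λ { r zero → refl ; r (suc c) → refl }))
         (cong₂ _+_
           (cong (- (+ 1) * A zero zero *_)
             (det-cong (suc k) {strike A' zero (suc zero)} {strike A zero zero} λ { r zero → refl ; r (suc c) → refl }))
           swapped-rest) ⟩
      + 1 * A zero (suc zero) * minor₀ (suc zero) + (- (+ 1) * A zero zero * minor₀ zero + - rest)
    ≡⟨ swap-first-terms (A zero zero) (A zero (suc zero)) (minor₀ zero) (minor₀ (suc zero)) rest ⟩
      - det (suc (suc k)) A
    ∎
    where
    open ≡-Reasoning
    A' : Matrix (suc (suc k)) (suc (suc k))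
    A' r c = A r (swap₀₁ c)
    minor₀ : Fin (suc (suc k)) → ℤ
    minor₀ c = det (suc k) (strike A zero c)
    term : Fin k → ℤ
    term j = sign {suc (suc k)} (suc (suc j)) * A zero (suc (suc j))
    rest : ℤ
    rest = sumFin k (λ j → term j * minor₀ (suc (suc j)))
    swapped-rest : sumFin k (λ j → term j * det (suc k) (strike A' zero (suc (suc j)))) ≡ - rest
    swapped-rest = trans
      (sumFin-cong k λ j → trans (cong (term j *_) (det-strike-swap-cols₀₁ k A j)) (sym (neg-distribʳ-* (term j) _)))
      (neg-distrib-sumFin k (λ j → term j * minor₀ (suc (suc j))))
    swap-first-terms : ∀ a b x y s → + 1 * b * y + (- (+ 1) * a * x + - s) ≡ - (+ 1 * a * x + (- (+ 1) * b * y + s))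
    swap-first-terms = solve-∀

  det-strike-swap-cols₀₁ zero    A ()
  det-strike-swap-cols₀₁ (suc k) A j = trans
    (det-cong (suc (suc k)) {strike (λ r c → A r (swap₀₁ c)) zero (suc (suc j))}
                            {λ r c → strike A zero (suc (suc j)) r (swap₀₁ c)}
      λ { r zero → refl ; r (suc zero) → refl ; r (suc (suc c)) → refl })
    (det-swap-cols₀₁ k (strike A zero (suc (suc j))))

  det-swap-rows₀₁ : ∀ k (A : Matrix (suc (suc k)) (suc (suc k))) →
    det (suc (suc k)) (λ r c → A (swap₀₁ r) c) ≡ - det (suc (suc k)) A
  det-swap-rows₀₁ k A = begin
      det (suc (suc k)) (λ r c → A (swap₀₁ r) c)     ≡⟨ sym (det-transpose (suc (suc k)) (λ r c → A (swap₀₁ r) c)) ⟩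
      det (suc (suc k)) (λ r c → (A ᵀ) r (swap₀₁ c)) ≡⟨ det-swap-cols₀₁ k (A ᵀ) ⟩
      - det (suc (suc k)) (A ᵀ)                      ≡⟨ cong -_ (det-transpose (suc (suc k)) A) ⟩
      - det (suc (suc k)) A                          ∎
    where open ≡-Reasoning

  toFront : ∀ {k} → Fin (suc k) → Fin (suc k) → Fin (suc k)
  toFront p zero    = p
  toFront p (suc t) = punchIn p t

  det-toFront-rows : ∀ k (p : Fin (suc k)) (A : Matrix (suc k) (suc k)) →
    det (suc k) (λ r c → A (toFront p r) c) ≡ sign p * det (suc k) A
  det-toFront-rows k zero A =
    trans (det-cong (suc k) {λ r c → A (toFront zero r) c} {A} λ { zero c → refl ; (suc r) c → refl })
          (sym (*-identityˡ _))
  det-toFront-rows (suc k) (suc p) A = begin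
      det (suc (suc k)) (λ r c → A (toFront (suc p) r) c)
    ≡⟨ det-cong (suc (suc k)) {λ r c → A (toFront (suc p) r) c} {λ r c → N (swap₀₁ r) c}
         (λ { zero c → refl ; (suc zero) c → refl ; (suc (suc r)) c → refl }) ⟩
      det (suc (suc k)) (λ r c → N (swap₀₁ r) c)
    ≡⟨ det-swap-rows₀₁ k N ⟩
      - det (suc (suc k)) N
    ≡⟨ cong -_ (sumFin-cong (suc (suc k)) (λ j → cong (sign j * A zero j *_) (det-toFront-rows k p (strike A zero j)))) ⟩
      - sumFin (suc (suc k)) (λ j → sign j * A zero j * (sign p * det (suc k) (strike A zero j)))
    ≡⟨ cong -_ (trans
         (sumFin-cong (suc (suc k)) (λ j → exchange (sign j * A zero j) (sign p) (det (suc k) (strike A zero j))))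
         (sym (*-distribˡ-sumFin (suc (suc k)) (sign p) (λ j → sign j * A zero j * det (suc k) (strike A zero j))))) ⟩
      - (sign p * det (suc (suc k)) A)
    ≡⟨ neg-distribˡ-* (sign p) _ ⟩
      sign (suc p) * det (suc (suc k)) A
    ∎
    where
    open ≡-Reasoning
    N : Matrix (suc (suc k)) (suc (suc k))
    N zero    c = A zero c
    N (suc t) c = A (suc (toFront p t)) c
    exchange : ∀ a b c → a * (b * c) ≡ b * (a * c)
    exchange = solve-∀

  det-dupRows₀₁ : ∀ k (A : Matrix (suc (suc k)) (suc (suc k))) →
    (∀ c → A zero c ≡ A (suc zero) c) → det (suc (suc k)) A ≡ + 0
  det-dupRows₀₁ k A eq = x≡-x⇒x≡0 _ (trans
    (det-cong (suc (suc k)) {A} {λ r c → A (swap₀₁ r) c}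
      (λ { zero c → eq c ; (suc zero) c → sym (eq c) ; (suc (suc r)) c → refl }))
    (det-swap-rows₀₁ k A))

  det-dupRows : ∀ k (A : Matrix (suc k) (suc k)) (p q : Fin (suc k)) → p ≢ q →
    (∀ c → A p c ≡ A q c) → det (suc k) A ≡ + 0
  det-dupRows zero    A zero zero p≢q eq = ⊥-elim (p≢q refl)
  det-dupRows (suc k) A p    q    p≢q eq =
    sgn-*-≡0 (toℕ p) _ (trans (sym (det-toFront-rows (suc k) p A))
      (sgn-*-≡0 (toℕ (suc t)) _ (trans (sym (det-toFront-rows (suc k) (suc t) A₁))
        (det-dupRows₀₁ k A₂ (λ c → trans (cong (λ z → A z c) (punchIn-punchOut p≢q)) (sym (eq c)))))))
    where
    t = punchOut p≢q
    A₁ A₂ : Matrix (suc (suc k)) (suc (suc k))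
    A₁ r c = A (toFront p r) c
    A₂ r c = A₁ (toFront (suc t) r) c

  cofactorExpansion : ∀ {k} → Matrix (suc k) (suc k) → Fin (suc k) → Fin (suc k) → ℤ
  cofactorExpansion {k} A r' r = sumFin (suc k) (λ c → sign c * A r' c * det k (strike A r c))

  det-expand-row : ∀ k (A : Matrix (suc k) (suc k)) (p : Fin (suc k)) →
    det (suc k) A ≡ sign p * cofactorExpansion A p p
  det-expand-row k A p =
    trans (sym (sgn-*-involutive (toℕ p) _)) (cong (sign p *_) (sym (det-toFront-rows k p A)))

  cofactorExpansion-alien : ∀ k (A : Matrix (suc k) (suc k)) (r' r : Fin (suc k)) → r' ≢ r →
    cofactorExpansion A r' r ≡ + 0
  cofactorExpansion-alien k A r' r r'≢r = sgn-*-≡0 (toℕ r) _ (trans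
    (cong (sign r *_) (sym (sumFin-cong (suc k) λ c → cong₂ (λ x y → sign c * x * y)
      (cong-app (updateAt-updates r {λ _ → A r'} A) c)
      (det-cong k {strike A' r c} {strike A r c} λ a b →
        cong-app (updateAt-minimal (punchIn r a) r A (punchInᵢ≢i r a)) (punchIn c b)))))
    (trans (sym (det-expand-row k A' r))
           (det-dupRows k A' r r' (r'≢r ∘ sym) (λ c → trans (cong-app (updateAt-updates r {λ _ → A r'} A) c)
              (sym (cong-app (updateAt-minimal r' r A r'≢r) c))))))
    where
    A' : Matrix (suc k) (suc k)
    A' = updateAt A r (λ _ → A r')

  det-toFront-cols : ∀ k (p : Fin (suc k)) (A : Matrix (suc k) (suc k)) →
    det (suc k) (λ r c → A r (toFront p c)) ≡ sign p * det (suc k) A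
  det-toFront-cols k p A = begin
      det (suc k) (λ r c → A r (toFront p c)) ≡⟨ sym (det-transpose (suc k) (λ r c → A r (toFront p c))) ⟩
      det (suc k) (λ r c → A c (toFront p r)) ≡⟨ det-toFront-rows k p (A ᵀ) ⟩
      sign p * det (suc k) (A ᵀ)              ≡⟨ cong (sign p *_) (det-transpose (suc k) A) ⟩
      sign p * det (suc k) A                  ∎
    where open ≡-Reasoning

  det-dupCols : ∀ k (A : Matrix (suc k) (suc k)) (p q : Fin (suc k)) → p ≢ q →
    (∀ r → A r p ≡ A r q) → det (suc k) A ≡ + 0
  det-dupCols k A p q p≢q eq = trans (sym (det-transpose (suc k) A)) (det-dupRows k (A ᵀ) p q p≢q eq)

module IncreasingMaps where

  open Determinant using (toFront)
  open import Level using (0ℓ)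
  open import Data.Nat using (zero; s<s; z<s)
  import Data.Nat.Properties as ℕ
  open import Data.Fin using (Fin; zero; suc; fromℕ; punchIn; punchOut; _<_; _≟_)
  open import Data.Fin.Properties using (punchIn-punchOut; <-cmp; <-trans; <-irrefl; ≤fromℕ; any?)
  open import Data.Product using (∃; _,_)
  open import Data.Sum using (_⊎_; inj₁; inj₂)
  open import Data.Empty using (⊥-elim)
  open import Data.Vec.Functional using (_∷_)
  open import Function using (_∘_)
  open import Function.Definitions using (Injective)
  open import Relation.Binary.Core using (_Preserves_⟶_)
  open import Relation.Binary.Definitions using (tri<; tri≈; tri>)
  open import Relation.Binary.PropositionalEquality
  open import Relation.Nullary using (Dec; yes; no)
  open import Relation.Unary using (Pred; _∈_; _∉_)

  StrictlyIncreasing : ∀ {k K} → (Fin k → Fin K) → Set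
  StrictlyIncreasing f = f Preserves _<_ ⟶ _<_

  image : ∀ {k K} → (Fin k → Fin K) → Pred (Fin K) 0ℓ
  image f x = ∃ λ t → f t ≡ x

  image? : ∀ {k K} (f : Fin k → Fin K) x → Dec (x ∈ image f)
  image? f x = any? (λ t → f t ≟ x)

  <⇒≢fromℕ : ∀ {n} {i j : Fin (suc n)} → i < j → i ≢ fromℕ n
  <⇒≢fromℕ i<j refl = ℕ.<⇒≱ i<j (≤fromℕ _)

  punchIn-mono-< : ∀ {n} (p : Fin (suc n)) → punchIn p Preserves _<_ ⟶ _<_
  punchIn-mono-< zero    a<b = s<s a<b
  punchIn-mono-< (suc p) {zero}  {suc b} a<b       = z<s
  punchIn-mono-< (suc p) {suc a} {suc b} (s<s a<b) = s<s (punchIn-mono-< p a<b)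

  increasing-∘-punchIn : ∀ {k K} {f : Fin (suc k) → Fin K} → StrictlyIncreasing f →
    ∀ p → StrictlyIncreasing (f ∘ punchIn p)
  increasing-∘-punchIn f↑ p = f↑ ∘ punchIn-mono-< p

  increasing⇒injective : ∀ {k K} {f : Fin k → Fin K} → StrictlyIncreasing f → Injective _≡_ _≡_ f
  increasing⇒injective f↑ {a} {b} fa≡fb with <-cmp a b
  ... | tri< a<b _ _ = ⊥-elim (<-irrefl fa≡fb (f↑ a<b))
  ... | tri≈ _ a≡b _ = a≡b
  ... | tri> _ _ b<a = ⊥-elim (<-irrefl (sym fa≡fb) (f↑ b<a))

  image-∘-punchIn : ∀ {k K} {f : Fin (suc k) → Fin K} {x} p → x ∈ image f → f p ≢ x →
    x ∈ image (f ∘ punchIn p)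
  image-∘-punchIn {f = f} p (t , ft≡x) fp≢x with t ≟ p
  ... | yes refl = ⊥-elim (fp≢x ft≡x)
  ... | no t≢p   = punchOut (t≢p ∘ sym) , trans (cong f (punchIn-punchOut (t≢p ∘ sym))) ft≡x

  pivot-or-punchIn : ∀ {k} (p b : Fin (suc k)) → b ≡ p ⊎ ∃ λ t → punchIn p t ≡ b
  pivot-or-punchIn p b with b ≟ p
  ... | yes b≡p = inj₁ b≡p
  ... | no b≢p  = inj₂ (punchOut (b≢p ∘ sym) , punchIn-punchOut (b≢p ∘ sym))

  record Insertion {k K} (f : Fin k → Fin K) (x : Fin K) : Set where
    field
      ext         : Fin (suc k) → Fin K
      pos         : Fin (suc k)
      increasing  : StrictlyIncreasing ext
      ext-pos     : ext pos ≡ x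
      ext-punchIn : ∀ t → ext (punchIn pos t) ≡ f t

    ext-toFront : ∀ r → ext (toFront pos r) ≡ (x ∷ f) r
    ext-toFront zero    = ext-pos
    ext-toFront (suc t) = ext-punchIn t

    image-ext : ∀ {y} → y ∈ image f → y ∈ image ext
    image-ext (t , ft≡y) = punchIn pos t , trans (ext-punchIn t) ft≡y

  insert : ∀ {k K} (f : Fin k → Fin K) → StrictlyIncreasing f → ∀ x → x ∉ image f → Insertion f x
  insert {zero}  f f↑ x x∉f = record
    { ext = λ _ → x ; pos = zero ; increasing = λ { {zero} {zero} () } ; ext-pos = refl ; ext-punchIn = λ () }
  insert {suc k} f f↑ x x∉f with <-cmp x (f zero)
  ... | tri≈ _ x≡f₀ _ = ⊥-elim (x∉f (zero , sym x≡f₀))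
  ... | tri< x<f₀ _ _ = record
    { ext = x ∷ f ; pos = zero ; increasing = ↑ ; ext-pos = refl ; ext-punchIn = λ _ → refl }
    where
    ↑ : StrictlyIncreasing (x ∷ f)
    ↑ {zero}  {suc zero}    _         = x<f₀
    ↑ {zero}  {suc (suc b)} _         = <-trans x<f₀ (f↑ z<s)
    ↑ {suc a} {suc b}       (s<s a<b) = f↑ a<b
  ... | tri> _ _ f₀<x = record
    { ext = f zero ∷ I.ext ; pos = suc I.pos ; increasing = ↑ ; ext-pos = I.ext-pos ; ext-punchIn = ext-punchIn }
    where
    x∉f∘suc : x ∉ image (f ∘ suc)
    x∉f∘suc (t , f₁₊ₜ≡x) = x∉f (suc t , f₁₊ₜ≡x)
    module I = Insertion (insert (f ∘ suc) (f↑ ∘ s<s) x x∉f∘suc)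
    f₀<ext : ∀ b → f zero < I.ext b
    f₀<ext b with pivot-or-punchIn I.pos b
    ... | inj₁ refl       = subst (f zero <_) (sym I.ext-pos) f₀<x
    ... | inj₂ (t , refl) = subst (f zero <_) (sym (I.ext-punchIn t)) (f↑ z<s)
    ↑ : StrictlyIncreasing (f zero ∷ I.ext)
    ↑ {zero}  {suc b} _         = f₀<ext b
    ↑ {suc a} {suc b} (s<s a<b) = I.increasing a<b
    ext-punchIn : ∀ t → (f zero ∷ I.ext) (punchIn (suc I.pos) t) ≡ f t
    ext-punchIn zero    = refl
    ext-punchIn (suc t) = I.ext-punchIn t

module DeterminantDivisibility where

  open import Data.Nat using (zero; NonZero; ≢-nonZero)
  import Data.Nat.Properties as ℕ
  open import Data.Fin using (Fin; zero; suc; punchIn)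
  open import Data.Nat.GCD using (gcd; gcd[m,n]∣m; gcd[m,n]∣n; gcd[m,n]≡0⇒n≡0)
  open import Data.Nat.DivMod using (_/_; m*n/n≡m)
  import Data.Nat.Coprimality as ℕ
  open import Data.Integer using (ℤ; +_; -_; _+_; _-_; _*_; ∣_∣)
  open import Data.Integer.Properties using (abs-*; +-identityʳ; i*j≡0⇒i≡0∨j≡0)
  open import Data.Integer.Divisibility.Signed
  open import Data.Integer.Coprimality using (Coprime; coprime-divisor)
  open import Data.Integer.Tactic.RingSolver using (solve-∀)
  open import Data.Sum using (inj₁; inj₂)
  open import Relation.Binary.PropositionalEquality
  open FinSum
  open Determinant

  ∣quotient∣ : ∀ {G} .{{_ : NonZero G}} {x} (G∣x : + G ∣ x) → ∣ quotient G∣x ∣ ≡ ∣ x ∣ / G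
  ∣quotient∣ {G} (divides q x≡qG) =
    sym (trans (cong (λ y → ∣ y ∣ / G) x≡qG) (trans (cong (_/ G) (abs-* q (+ G))) (m*n/n≡m ∣ q ∣ G)))

  -- Write m = m'G and d = d'G with G = gcd(m, d); then d' and m' are coprime and d'² ∣ m'(m' − qd').
  d∣n∧d²∣m[m-n]⇒d∣m : ∀ d m n → + d ∣ n → + d * + d ∣ m * (m - n) → + d ∣ m
  d∣n∧d²∣m[m-n]⇒d∣m zero m n 0∣n 0∣m[m-n] with refl ← 0∣⇒≡0 0∣n
    with i*j≡0⇒i≡0∨j≡0 m (trans (cong (m *_) (sym (+-identityʳ m))) (0∣⇒≡0 0∣m[m-n]))
  ... | inj₁ refl = _ ∣0
  ... | inj₂ refl = _ ∣0
  d∣n∧d²∣m[m-n]⇒d∣m d@(suc _) m n (divides q n≡qd) d²∣m[m-n] =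
    subst₂ _∣_ (sym d≡d'G) (sym m≡m'G) (*-monoˡ-∣ (+ G) d'∣m')
    where
    G : ℕ
    G = gcd ∣ m ∣ d
    instance
      G≢0 : NonZero G
      G≢0 = ≢-nonZero (λ G≡0 → ℕ.1+n≢0 (gcd[m,n]≡0⇒n≡0 ∣ m ∣ G≡0))
    G∣m : + G ∣ m
    G∣m = ∣ᵤ⇒∣ (gcd[m,n]∣m ∣ m ∣ d)
    G∣d : + G ∣ + d
    G∣d = ∣ᵤ⇒∣ (gcd[m,n]∣n ∣ m ∣ d)
    m' d' : ℤ
    m' = quotient G∣m
    d' = quotient G∣d
    m≡m'G : m ≡ m' * + G
    m≡m'G = _∣_.equality G∣m
    d≡d'G : + d ≡ d' * + G
    d≡d'G = _∣_.equality G∣d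
    coprime : Coprime d' m'
    coprime = subst₂ ℕ.Coprime (sym (∣quotient∣ G∣d)) (sym (∣quotient∣ G∣m)) (ℕ.sym (ℕ.coprime-/gcd ∣ m ∣ d))
    factor-m : ∀ a b c g → (a * g) * ((a * g) - b * (c * g)) ≡ g * (g * (a * (a - b * c)))
    factor-m = solve-∀
    factor-d : ∀ c g → (c * g) * (c * g) ≡ g * (g * (c * c))
    factor-d = solve-∀
    d'²∣ : d' * d' ∣ m' * (m' - q * d')
    d'²∣ = *-cancelˡ-∣ (+ G) (*-cancelˡ-∣ (+ G) (subst₂ _∣_
      (trans (cong₂ _*_ d≡d'G d≡d'G) (factor-d d' (+ G)))
      (trans (cong₂ (λ x y → x * (x - y)) m≡m'G (trans n≡qd (cong (q *_) d≡d'G))) (factor-m m' q d' (+ G)))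
      d²∣m[m-n]))
    d'∣m'-qd' : d' ∣ m' - q * d'
    d'∣m'-qd' = ∣ᵤ⇒∣ (coprime-divisor d' m' _ coprime (∣⇒∣ᵤ (∣-trans (∣m⇒∣m*n {d'} d' ∣-refl) d'²∣)))
    cancel-shift : ∀ a b → a - b + b ≡ a
    cancel-shift = solve-∀
    d'∣m' : d' ∣ m'
    d'∣m' = subst (d' ∣_) (cancel-shift m' (q * d')) (∣m∣n⇒∣m+n d'∣m'-qd' (∣n⇒∣m*n q ∣-refl))

  *-pres-∣ : ∀ {a b x y} → a ∣ x → b ∣ y → a * b ∣ x * y
  *-pres-∣ {a} {y = y} a∣x b∣y = ∣-trans (*-monoʳ-∣ a b∣y) (*-monoˡ-∣ y a∣x)

  d∣Δ-u∧d∣-Δ-v∧d²∣uv⇒d∣Δ : ∀ d Δ u v → + d ∣ Δ - u → + d ∣ - Δ - v → + d * + d ∣ u * v → + d ∣ Δ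
  d∣Δ-u∧d∣-Δ-v∧d²∣uv⇒d∣Δ d Δ u v d∣Δ-u d∣-Δ-v d²∣uv =
    d∣n∧d²∣m[m-n]⇒d∣m d Δ ((Δ - u) - (- Δ - v)) (∣m∣n⇒∣m-n d∣Δ-u d∣-Δ-v)
      (subst (_ ∣_) (sym (expand Δ u v)) (∣m∣n⇒∣m-n (*-pres-∣ d∣Δ-u d∣-Δ-v) d²∣uv))
    where
    expand : ∀ Δ u v → Δ * (Δ - ((Δ - u) - (- Δ - v))) ≡ (Δ - u) * (- Δ - v) - u * v
    expand = solve-∀

  ∣det-if-∣cofactors₀₁ : ∀ k d (X : Matrix (suc (suc k)) (suc (suc k))) (c₀ : Fin (suc (suc k))) →
    (∀ c' → + d ∣ det (suc k) (strike X zero (punchIn c₀ c'))) →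
    (∀ c' → + d ∣ det (suc k) (strike X (suc zero) (punchIn c₀ c'))) →
    + d ∣ det (suc (suc k)) X
  ∣det-if-∣cofactors₀₁ k d X c₀ cofactors₀∣ cofactors₁∣ =
    d∣Δ-u∧d∣-Δ-v∧d²∣uv⇒d∣Δ d (det _ X) (e r₀ r₀) (e r₁ r₁)
      (∣-residue (expansion-split r₀ r₀) (rest∣ r₀ r₀ cofactors₀∣))
      (∣-residue (trans (negate (det-expand-row _ X r₁)) (expansion-split r₁ r₁)) (rest∣ r₁ r₁ cofactors₁∣))
      (subst (_ ∣_) (sym (exchange (sign c₀) (X r₀ c₀) (X r₁ c₀) (C r₀) (C r₁)))
        (*-pres-∣ (alien∣ r₁ r₀ (λ ()) cofactors₀∣) (alien∣ r₀ r₁ (λ ()) cofactors₁∣)))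
    where
    r₀ r₁ : Fin (suc (suc k))
    r₀ = zero
    r₁ = suc zero
    C : Fin (suc (suc k)) → ℤ
    C r = det _ (strike X r c₀)
    e : Fin (suc (suc k)) → Fin (suc (suc k)) → ℤ
    e r' r = sign c₀ * X r' c₀ * C r
    rest : Fin (suc (suc k)) → Fin (suc (suc k)) → ℤ
    rest r' r = sumFin (suc k) (λ c' → sign (punchIn c₀ c') * X r' (punchIn c₀ c') * det _ (strike X r (punchIn c₀ c')))
    expansion-split : ∀ r' r → cofactorExpansion X r' r ≡ e r' r + rest r' r
    expansion-split r' r = sumFin-extract _ c₀ (λ c → sign c * X r' c * det _ (strike X r c))
    rest∣ : ∀ r' r → (∀ c' → + d ∣ det (suc k) (strike X r (punchIn c₀ c'))) → + d ∣ rest r' r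
    rest∣ r' r cofactors∣ = ∣-sumFin _ _ λ c' → ∣n⇒∣m*n (sign (punchIn c₀ c') * X r' (punchIn c₀ c')) (cofactors∣ c')
    alien∣ : ∀ r' r → r' ≢ r → (∀ c' → + d ∣ det (suc k) (strike X r (punchIn c₀ c'))) → + d ∣ e r' r
    alien∣ r' r r'≢r cofactors∣ =
      ∣-pivot (trans (sym (cofactorExpansion-alien _ X r' r r'≢r)) (expansion-split r' r)) (_ ∣0) (rest∣ r' r cofactors∣)
    negate : ∀ {x y} → x ≡ - (+ 1) * y → - x ≡ y
    negate {x} {y} x≡-y = trans (cong -_ x≡-y) (neg-neg y)
      where
      neg-neg : ∀ y → - (- (+ 1) * y) ≡ y
      neg-neg = solve-∀
    exchange : ∀ s x₀ x₁ c₀ c₁ → s * x₀ * c₀ * (s * x₁ * c₁) ≡ s * x₁ * c₀ * (s * x₀ * c₁)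
    exchange = solve-∀

module MinorLists where

  open IncreasingMaps using (StrictlyIncreasing; image)
  open import Data.Nat using (zero; _*_; s<s; z<s; s<s⁻¹)
  open import Data.Nat.Properties using (*-zeroʳ)
  open import Data.Nat.Tactic.RingSolver using (solve-∀)
  open import Data.Nat.Divisibility using (_∣_; _∣0; ∣-trans)
  open import Data.Nat.GCD using (gcd[m,n]∣m; gcd[m,n]∣n; gcd-greatest; c*gcd[m,n]≡gcd[cm,cn])
  open import Data.Fin using (Fin; zero; suc; punchOut; _<_; _≟_)
  open import Data.Fin.Properties using (punchIn-punchOut; <-trans; <⇒≢)
  open import Data.Integer using (∣_∣)
  open import Data.Vec using (Vec; _∷_; lookup; tabulate)
  import Data.Vec as Vec
  open import Data.Vec.Properties using (lookup-map; tabulate-cong; tabulate-∘)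
  open import Data.List as List using (List; filterᵇ; cartesianProduct)
  open import Data.List.Membership.Propositional renaming (_∈_ to _∈ₗ_)
  open import Data.List.Membership.Propositional.Properties
    using (∈-map⁺; ∈-map⁻; ∈-++⁺ˡ; ∈-++⁺ʳ; ∈-++⁻; ∈-filter⁺)
  open import Data.List.Relation.Unary.Any using (here; there)
  open import Data.Product using (_,_)
  open import Data.Sum using (inj₁; inj₂)
  open import Data.Bool using (Bool; true; T; _∨_)
  open import Data.Bool.Properties using (∨-zeroʳ)
  open import Data.Unit using (tt)
  open import Function using (_∘_)
  open import Relation.Nullary.Decidable using (⌊_⌋; T?; dec-true; isYes≗does)
  open import Relation.Binary.PropositionalEquality

  map-suc-increasing : ∀ {k K} (w : Vec (Fin K) k) → StrictlyIncreasing (lookup w) →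
    StrictlyIncreasing (lookup (Vec.map suc w))
  map-suc-increasing w w↑ {a} {b} a<b =
    subst₂ _<_ (sym (lookup-map a suc w)) (sym (lookup-map b suc w)) (s<s (w↑ a<b))

  ∈subsets⇒increasing : ∀ k K (v : Vec (Fin K) k) → v ∈ₗ subsets k K → StrictlyIncreasing (lookup v)
  ∈subsets⇒increasing zero    K       _   _ {()}
  ∈subsets⇒increasing (suc k) (suc K) v v∈ with ∈-++⁻ (List.map (λ w → zero ∷ Vec.map suc w) (subsets k K)) v∈
  ... | inj₁ v∈₁ with w , w∈ , refl ← ∈-map⁻ (λ w → zero ∷ Vec.map suc w) v∈₁ = ↑
    where
    ↑ : StrictlyIncreasing (lookup (zero ∷ Vec.map suc w))
    ↑ {zero}  {suc b} _         = subst (zero {K} <_) (sym (lookup-map b suc w)) z<s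
    ↑ {suc a} {suc b} (s<s a<b) = map-suc-increasing w (∈subsets⇒increasing k K w w∈) a<b
  ... | inj₂ v∈₂ with w , w∈ , refl ← ∈-map⁻ (Vec.map suc) v∈₂ =
    map-suc-increasing w (∈subsets⇒increasing (suc k) K w w∈)

  module Lowered {k K} (f : Fin k → Fin (suc K)) (f↑ : StrictlyIncreasing f) (0<f : ∀ t → zero {K} < f t) where

    lower : Fin k → Fin K
    lower t = punchOut (<⇒≢ (0<f t))

    lower↑ : StrictlyIncreasing lower
    lower↑ {a} {b} a<b = s<s⁻¹ (subst₂ _<_ (sym (punchIn-punchOut (<⇒≢ (0<f a))))
                                           (sym (punchIn-punchOut (<⇒≢ (0<f b)))) (f↑ a<b))

    tabulate-lower : tabulate f ≡ Vec.map suc (tabulate lower)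
    tabulate-lower = trans (tabulate-cong (sym ∘ punchIn-punchOut ∘ <⇒≢ ∘ 0<f)) (tabulate-∘ suc lower)

  tabulate∈subsets : ∀ k K (f : Fin k → Fin K) → StrictlyIncreasing f → tabulate f ∈ₗ subsets k K
  tabulate∈subsets zero    K       f f↑ = here refl
  tabulate∈subsets (suc k) zero    f f↑ with () ← f zero
  tabulate∈subsets (suc k) (suc K) f f↑ with f zero in f₀≡
  ... | zero = ∈-++⁺ˡ (subst (_∈ₗ List.map (λ w → zero ∷ Vec.map suc w) (subsets k K))
    (sym (cong (zero ∷_) tabulate-lower))
    (∈-map⁺ (λ w → zero ∷ Vec.map suc w) (tabulate∈subsets k K lower lower↑)))
    where
    0<f∘suc : ∀ t → zero {K} < f (suc t)
    0<f∘suc t = subst (_< f (suc t)) f₀≡ (f↑ z<s)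
    open Lowered (f ∘ suc) (f↑ ∘ s<s) 0<f∘suc
  ... | suc j = ∈-++⁺ʳ _ (subst (_∈ₗ List.map (Vec.map suc) (subsets (suc k) K))
    (sym (trans (cong (_∷ tabulate (f ∘ suc)) (sym f₀≡)) tabulate-lower))
    (∈-map⁺ (Vec.map suc) (tabulate∈subsets (suc k) K lower lower↑)))
    where
    0<f : ∀ t → zero {K} < f t
    0<f zero    = subst (zero {K} <_) (sym f₀≡) z<s
    0<f (suc t) = <-trans (0<f zero) (f↑ z<s)
    open Lowered f f↑ 0<f

  lookup-memb : ∀ {K k} (v : Vec (Fin K) k) t → memb (lookup v t) v ≡ true
  lookup-memb (y ∷ v) zero    = cong (_∨ memb y v) (trans (isYes≗does (y ≟ y)) (dec-true (y ≟ y) refl))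
  lookup-memb (y ∷ v) (suc t) = trans (cong (⌊ lookup v t ≟ y ⌋ ∨_) (lookup-memb v t)) (∨-zeroʳ _)

  image⇒memb : ∀ {K k} (v : Vec (Fin K) k) {x} → image (lookup v) x → memb x v ≡ true
  image⇒memb v (t , refl) = lookup-memb v t

  ∈-filterᵇ⁺ : ∀ {A : Set} (p : A → Bool) {x xs} → x ∈ₗ xs → p x ≡ true → x ∈ₗ filterᵇ p xs
  ∈-filterᵇ⁺ p x∈xs px≡true = ∈-filter⁺ (T? ∘ p) x∈xs (subst T (sym px≡true) tt)

  allPairs≡cartesianProduct : ∀ {A C : Set} (xs : List A) (ys : List C) → allPairs xs ys ≡ cartesianProduct xs ys
  allPairs≡cartesianProduct List.[]       ys = refl
  allPairs≡cartesianProduct (x List.∷ xs) ys = cong (List.map (x ,_) ys List.++_) (allPairs≡cartesianProduct xs ys)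

  gcdList∣ : ∀ {x xs} → x ∈ₗ xs → gcdList xs ∣ ∣ x ∣
  gcdList∣                   (here refl) = gcd[m,n]∣m _ _
  gcdList∣ {xs = y List.∷ _} (there x∈)  = ∣-trans (gcd[m,n]∣n ∣ y ∣ _) (gcdList∣ x∈)

  ∣*gcdList : ∀ {d} c xs → (∀ {x} → x ∈ₗ xs → d ∣ c * ∣ x ∣) → d ∣ c * gcdList xs
  ∣*gcdList {d} c List.[]       h = subst (d ∣_) (sym (*-zeroʳ c)) (d ∣0)
  ∣*gcdList {d} c (x List.∷ xs) h = subst (d ∣_) (sym (c*gcd[m,n]≡gcd[cm,cn] c ∣ x ∣ _))
    (gcd-greatest (h (here refl)) (∣*gcdList c xs (h ∘ there)))

  ∣gcdList³ : ∀ {d} xs ys zs →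
    (∀ {x y z} → x ∈ₗ xs → y ∈ₗ ys → z ∈ₗ zs → d ∣ ∣ x ∣ * ∣ y ∣ * ∣ z ∣) →
    d ∣ gcdList xs * gcdList ys * gcdList zs
  ∣gcdList³ {d} xs ys zs h =
    ∣*gcdList (gcdList xs * gcdList ys) zs λ {z} z∈ →
      rotate (gcdList ys) (∣ z ∣) (gcdList xs) (∣*gcdList (gcdList ys * ∣ z ∣) xs λ {x} x∈ →
        rotate (∣ z ∣) (∣ x ∣) (gcdList ys) (∣*gcdList (∣ z ∣ * ∣ x ∣) ys λ {y} y∈ →
          rotate (∣ x ∣) (∣ y ∣) (∣ z ∣) (h x∈ y∈ z∈)))
    where
    rotation : ∀ a b c → a * b * c ≡ c * a * b
    rotation = solve-∀
    rotate : ∀ a b c → d ∣ a * b * c → d ∣ c * a * b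
    rotate a b c = subst (d ∣_) (rotation a b c)

module CornerMinors {m n : ℕ} (B : Matrix (suc m) (suc n)) where

  open FinSum
  open Determinant
  open IncreasingMaps
  open DeterminantDivisibility using (∣det-if-∣cofactors₀₁)
  open import Data.Nat using (s<s; z<s)
  open import Data.Fin using (Fin; zero; suc; fromℕ; toℕ; punchIn)
  open import Data.Fin.Properties using (punchInᵢ≢i)
  open import Data.Integer using (ℤ; +_; _*_)
  open import Data.Integer.Properties using (*-assoc; *-zeroʳ; *-distribˡ-+)
  open import Data.Integer.Divisibility.Signed using (_∣_; ∣n⇒∣m*n)
  open import Data.Integer.Tactic.RingSolver using (solve-∀)
  open import Data.Product using (_,_)
  open import Data.Vec.Functional using (_∷_)
  open import Relation.Nullary using (yes; no)
  open import Function using (_∘_)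
  open import Relation.Binary.PropositionalEquality
  open import Relation.Unary using (_∈_)

  lastRow : Fin (suc m)
  lastRow = fromℕ m

  lastCol : Fin (suc n)
  lastCol = fromℕ n

  subMatrix : ∀ {j} → (Fin j → Fin (suc m)) → (Fin j → Fin (suc n)) → Matrix j j
  subMatrix f g r c = B (f r) (g c)

  CornerMinorsDivisible : ℕ → ℤ → Set
  CornerMinorsDivisible j d = ∀ f g → StrictlyIncreasing f → StrictlyIncreasing g →
    lastRow ∈ image f → lastCol ∈ image g → d ∣ det j (subMatrix f g)

  cornerMinors-step : ∀ k d → CornerMinorsDivisible (suc (suc k)) (+ d) → CornerMinorsDivisible (suc (suc (suc k))) (+ d)
  cornerMinors-step k d corner f g f↑ g↑ last∈f (c₀ , gc₀≡last) =
    ∣det-if-∣cofactors₀₁ (suc k) d (subMatrix f g) c₀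
      (cofactor∣ zero (<⇒≢fromℕ (f↑ {zero} {r₂} z<s)))
      (cofactor∣ (suc zero) (<⇒≢fromℕ (f↑ {suc zero} {r₂} (s<s z<s))))
    where
    r₂ : Fin (suc (suc (suc k)))
    r₂ = suc (suc zero)
    cofactor∣ : ∀ r → f r ≢ lastRow → ∀ c' → + d ∣ det (suc (suc k)) (strike (subMatrix f g) r (punchIn c₀ c'))
    cofactor∣ r fr≢last c' = corner (f ∘ punchIn r) (g ∘ punchIn (punchIn c₀ c'))
      (increasing-∘-punchIn f↑ r) (increasing-∘-punchIn g↑ (punchIn c₀ c')) (image-∘-punchIn r last∈f fr≢last)
      (image-∘-punchIn {f = g} (punchIn c₀ c') (c₀ , gc₀≡last) λ gc≡last →
        punchInᵢ≢i c₀ c' (increasing⇒injective g↑ (trans gc≡last (sym gc₀≡last))))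

  det-cons-rows : ∀ {k} {x} {f : Fin k → Fin (suc m)} (I : Insertion f x) (g : Fin (suc k) → Fin (suc n)) →
    det (suc k) (subMatrix (x ∷ f) g) ≡ sign (Insertion.pos I) * det (suc k) (subMatrix (Insertion.ext I) g)
  det-cons-rows {k} I g = trans (det-cong (suc k) λ r c → cong (λ y → B y (g c)) (sym (ext-toFront r)))
                                (det-toFront-rows k pos (subMatrix ext g))
    where open Insertion I

  det-cons-cols : ∀ {k} {x} {g : Fin k → Fin (suc n)} (I : Insertion g x) (f : Fin (suc k) → Fin (suc m)) →
    det (suc k) (subMatrix f (x ∷ g)) ≡ sign (Insertion.pos I) * det (suc k) (subMatrix f (Insertion.ext I))
  det-cons-cols {k} I f = trans (det-cong (suc k) λ r c → cong (B (f r)) (sym (ext-toFront c)))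
                                (det-toFront-cols k pos (subMatrix f ext))
    where open Insertion I

  module _ (k d : ℕ) (corner : CornerMinorsDivisible (suc (suc k)) (+ d)) where

    private
      K : ℕ
      K = suc (suc k)

    ∣det-cons-row : ∀ i f g → StrictlyIncreasing f → StrictlyIncreasing g →
      lastRow ∈ image f → lastCol ∈ image g → + d ∣ det (suc K) (subMatrix (i ∷ f) g)
    ∣det-cons-row i f g f↑ g↑ last∈f last∈g with image? f i
    ... | yes (t , ft≡i) = subst (_ ∣_)
      (sym (det-dupRows K (subMatrix (i ∷ f) g) zero (suc t) (λ ()) λ c → cong (λ y → B y (g c)) (sym ft≡i)))
      (_ ∣0)
    ... | no i∉f = subst (_ ∣_) (sym (det-cons-rows I g))
      (∣n⇒∣m*n (sign pos) (cornerMinors-step k d corner ext g increasing g↑ (image-ext last∈f) last∈g))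
      where
      I : Insertion f i
      I = insert f f↑ i i∉f
      open Insertion I

    ∣lastColEntry*minor : ∀ i f g → StrictlyIncreasing f → StrictlyIncreasing g → lastRow ∈ image f →
      + d ∣ B i lastCol * det K (subMatrix f g)
    ∣lastColEntry*minor i f g f↑ g↑ last∈f with image? g lastCol
    ... | yes last∈g = ∣n⇒∣m*n (B i lastCol) (corner f g f↑ g↑ last∈f last∈g)
    ... | no last∉g  = ∣sgn*⇒∣ (toℕ pos) _ (subst (_ ∣_) pivot-term
      (∣-pivot (sumFin-extract K pos term) (∣det-cons-row i f ext f↑ increasing last∈f (pos , ext-pos)) rest∣))
      where
      open Insertion (insert g g↑ lastCol last∉g)
      term : Fin (suc K) → ℤ
      term c = sign c * B i (ext c) * det K (subMatrix f (ext ∘ punchIn c))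
      rest∣ : + d ∣ sumFin K (term ∘ punchIn pos)
      rest∣ = ∣-sumFin K (term ∘ punchIn pos) λ c' → ∣n⇒∣m*n (sign (punchIn pos c') * B i (ext (punchIn pos c')))
        (corner f (ext ∘ punchIn (punchIn pos c')) f↑ (increasing-∘-punchIn increasing (punchIn pos c')) last∈f
        (image-∘-punchIn {f = ext} (punchIn pos c') (pos , ext-pos) λ e → last∉g (c' , trans (sym (ext-punchIn c')) e)))
      pivot-term : term pos ≡ sign pos * (B i lastCol * det K (subMatrix f g))
      pivot-term = trans
        (cong₂ (λ y z → sign pos * B i y * z) ext-pos (det-cong K λ r c → cong (B (f r)) (ext-punchIn c)))
        (*-assoc (sign pos) _ _)

    ∣lastColEntry*minor⁺ : ∀ i f g → StrictlyIncreasing f → StrictlyIncreasing g → lastRow ∈ image f →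
      + d ∣ B i lastCol * det (suc K) (subMatrix f g)
    ∣lastColEntry*minor⁺ i f g f↑ g↑ last∈f =
      ∣*-sumFin (B i lastCol) (suc K) (λ c → sign c * B (f zero) (g c))
                                      (λ c → det K (subMatrix (f ∘ suc) (g ∘ punchIn c)))
        λ c → ∣lastColEntry*minor i (f ∘ suc) (g ∘ punchIn c) (f↑ ∘ s<s) (increasing-∘-punchIn g↑ c)
                (image-∘-punchIn zero last∈f (<⇒≢fromℕ (f↑ {zero} {suc zero} z<s)))

    ∣lastColEntry*det-cons-col : ∀ i j f g → StrictlyIncreasing f → StrictlyIncreasing g → lastRow ∈ image f →
      + d ∣ B i lastCol * det (suc K) (subMatrix f (j ∷ g))
    ∣lastColEntry*det-cons-col i j f g f↑ g↑ last∈f with image? g j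
    ... | yes (t , gt≡j) = subst (_ ∣_)
      (sym (trans (cong (B i lastCol *_)
                    (det-dupCols K (subMatrix f (j ∷ g)) zero (suc t) (λ ()) λ r → cong (B (f r)) (sym gt≡j)))
                  (*-zeroʳ (B i lastCol))))
      (_ ∣0)
    ... | no j∉g = subst (_ ∣_)
      (sym (trans (cong (B i lastCol *_) (det-cons-cols I f)) (exchange (B i lastCol) (sign pos) _)))
      (∣n⇒∣m*n (sign pos) (∣lastColEntry*minor⁺ i f ext f↑ increasing last∈f))
      where
      I : Insertion g j
      I = insert g g↑ j j∉g
      open Insertion I
      exchange : ∀ x s y → x * (s * y) ≡ s * (x * y)
      exchange = solve-∀

    ∣lastColEntry*lastRowEntry*minor : ∀ i j f g → StrictlyIncreasing f → StrictlyIncreasing g →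
      + d ∣ B i lastCol * B lastRow j * det K (subMatrix f g)
    ∣lastColEntry*lastRowEntry*minor i j f g f↑ g↑ with image? f lastRow
    ... | yes last∈f = subst (_ ∣_) (exchange (B i lastCol) (B lastRow j) _)
      (∣n⇒∣m*n (B lastRow j) (∣lastColEntry*minor i f g f↑ g↑ last∈f))
      where
      exchange : ∀ x y z → y * (x * z) ≡ x * y * z
      exchange = solve-∀
    ... | no last∉f = ∣sgn*⇒∣ (toℕ pos) _ (subst (_ ∣_) pivot-term (∣-pivot
      (trans (cong (B i lastCol *_) (trans (det-expand-col₀ K Z) (sumFin-extract K pos term)))
             (*-distribˡ-+ (B i lastCol) _ _))
      (∣lastColEntry*det-cons-col i j ext g increasing g↑ (pos , ext-pos))
      (∣*-sumFin (B i lastCol) K (λ r' → sign (punchIn pos r') * B (ext (punchIn pos r')) j)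
        (λ r' → det K (subMatrix (ext ∘ punchIn (punchIn pos r')) g))
        λ r' → ∣lastColEntry*minor i (ext ∘ punchIn (punchIn pos r')) g
                 (increasing-∘-punchIn increasing (punchIn pos r')) g↑
                 (image-∘-punchIn {f = ext} (punchIn pos r') (pos , ext-pos) λ e →
                   last∉f (r' , trans (sym (ext-punchIn r')) e)))))
      where
      open Insertion (insert f f↑ lastRow last∉f)
      Z : Matrix (suc K) (suc K)
      Z = subMatrix ext (j ∷ g)
      term : Fin (suc K) → ℤ
      term r = sign r * B (ext r) j * det K (subMatrix (ext ∘ punchIn r) g)
      exchange : ∀ x s y z → x * (s * y * z) ≡ s * (x * y * z)
      exchange = solve-∀
      pivot-term : B i lastCol * term pos ≡ sign pos * (B i lastCol * B lastRow j * det K (subMatrix f g))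
      pivot-term = trans
        (cong₂ (λ y z → B i lastCol * (sign pos * B y j * z)) ext-pos
               (det-cong K λ r c → cong (λ y → B y (g c)) (ext-punchIn r)))
        (exchange (B i lastCol) (sign pos) (B lastRow j) _)

open MinorLists
open CornerMinors using (CornerMinorsDivisible; ∣lastColEntry*lastRowEntry*minor)
open import Data.Nat using (_*_; _≤_; s≤s)
open import Data.Nat.Divisibility using (_∣_)
open import Data.Fin using (Fin; fromℕ)
open import Data.Integer using (+_; ∣_∣)
import Data.Integer as ℤ
open import Data.Integer.Properties using (abs-*)
open import Data.Integer.Divisibility.Signed using (∣ᵤ⇒∣; ∣⇒∣ᵤ)
open import Data.List using (List; map; allFin; filterᵇ)
open import Data.List.Membership.Propositional renaming (_∈_ to _∈ₗ_)
open import Data.List.Membership.Propositional.Properties using (∈-map⁺; ∈-map⁻; ∈-cartesianProduct⁺; ∈-cartesianProduct⁻)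
open import Data.Product using (_,_; proj₁; proj₂)
open import Data.Vec using (Vec; lookup; tabulate)
open import Data.Vec.Properties using (lookup∘tabulate)
open import Relation.Binary.PropositionalEquality

Dstar-∣-cornerMinors : ∀ {m n} (B : Matrix (suc m) (suc n)) k → CornerMinorsDivisible B k (+ Dstar k B)
Dstar-∣-cornerMinors {m} {n} B k f g f↑ g↑ (s , fs≡last) (t , gt≡last) =
  ∣ᵤ⇒∣ (subst (λ x → Dstar k B ∣ ∣ x ∣) minor≡
    (gcdList∣ (∈-map⁺ (λ p → minor B (proj₁ p) (proj₂ p))
      (subst ((tabulate f , tabulate g) ∈ₗ_) (sym (allPairs≡cartesianProduct rowSets colSets))
        (∈-cartesianProduct⁺ I∈ J∈)))))
  where
  rowSets : List (Vec (Fin (suc m)) k)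
  rowSets = filterᵇ (memb (fromℕ m)) (subsets k (suc m))
  colSets : List (Vec (Fin (suc n)) k)
  colSets = filterᵇ (memb (fromℕ n)) (subsets k (suc n))
  I∈ : tabulate f ∈ₗ rowSets
  I∈ = ∈-filterᵇ⁺ _ (tabulate∈subsets k (suc m) f f↑)
         (image⇒memb (tabulate f) (s , trans (lookup∘tabulate f s) fs≡last))
  J∈ : tabulate g ∈ₗ colSets
  J∈ = ∈-filterᵇ⁺ _ (tabulate∈subsets k (suc n) g g↑)
         (image⇒memb (tabulate g) (t , trans (lookup∘tabulate g t) gt≡last))
  minor≡ : minor B (tabulate f) (tabulate g) ≡ det k (CornerMinors.subMatrix B f g)
  minor≡ = Determinant.det-cong k λ r c → cong₂ B (lookup∘tabulate f r) (lookup∘tabulate g c)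

Dstar-∣-lastColEntry*lastRowEntry*minor : ∀ {m n} (B : Matrix (suc m) (suc n)) k i j {I J} →
  I ∈ₗ subsets (suc (suc k)) (suc m) → J ∈ₗ subsets (suc (suc k)) (suc n) →
  Dstar (suc (suc k)) B ∣ ∣ B i (fromℕ n) ∣ * ∣ B (fromℕ m) j ∣ * ∣ minor B I J ∣
Dstar-∣-lastColEntry*lastRowEntry*minor {m} {n} B k i j {I} {J} I∈ J∈ =
  subst (Dstar (suc (suc k)) B ∣_) (trans (abs-* (x ℤ.* y) (minor B I J)) (cong (_* ∣ minor B I J ∣) (abs-* x y)))
    (∣⇒∣ᵤ (∣lastColEntry*lastRowEntry*minor B k (Dstar (suc (suc k)) B) (Dstar-∣-cornerMinors B (suc (suc k)))
      i j (lookup I) (lookup J) (∈subsets⇒increasing _ (suc m) I I∈) (∈subsets⇒increasing _ (suc n) J J∈)))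
  where
  x y : ℤ.ℤ
  x = B i (fromℕ n)
  y = B (fromℕ m) j

lemma3p4 : (m n : ℕ) (B : Matrix (suc m) (suc n)) (k : ℕ) →
    2 ≤ k → k ≤ suc m → k ≤ suc n →
    Dstar k B ∣ g (fromℕ n) (B ᵀ) * g (fromℕ m) B * D k B
lemma3p4 m n B (suc (suc k)) (s≤s (s≤s _)) _ _ = ∣gcdList³ _ _ _ products∣
  where
  rowSets : List (Vec (Fin (suc m)) (suc (suc k)))
  rowSets = subsets (suc (suc k)) (suc m)
  colSets : List (Vec (Fin (suc n)) (suc (suc k)))
  colSets = subsets (suc (suc k)) (suc n)
  products∣ : ∀ {x y z} →
    x ∈ₗ map (λ i → B i (fromℕ n)) (allFin (suc m)) →
    y ∈ₗ map (B (fromℕ m)) (allFin (suc n)) →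
    z ∈ₗ map (λ p → minor B (proj₁ p) (proj₂ p)) (allPairs rowSets colSets) →
    Dstar (suc (suc k)) B ∣ ∣ x ∣ * ∣ y ∣ * ∣ z ∣
  products∣ x∈ y∈ z∈
    with i , _ , refl ← ∈-map⁻ _ x∈
       | j , _ , refl ← ∈-map⁻ _ y∈
       | (I , J) , IJ∈ , refl ← ∈-map⁻ _ z∈
    with I∈ , J∈ ← ∈-cartesianProduct⁻ rowSets colSets
                      (subst ((I , J) ∈ₗ_) (allPairs≡cartesianProduct rowSets colSets) IJ∈) =
    Dstar-∣-lastColEntry*lastRowEntry*minor B k i j I∈ J∈
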